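{- Let $T$ be a finite set of tense formulas with $\top,\bot\in T$. For any $\varphi,\psi\in T^\circ$: $\Diamond_c[\![\varphi]\!]\subseteq[\![\psi]\!]$ if and only if $[\![\varphi]\!]\subseteq\blacksquare[\![\psi]\!]$.
   Context: Tense formulas are built from a countable set of propositional variables using $\bot,\top$, unary $\neg,\Diamond,\blacksquare$ and binary $\wedge,\vee$; $\Diamond^0\varphi=\varphi$, $\Diamond^{k+1}\varphi=\Diamond\Diamond^k\varphi$. Formula structures: $\langle\varphi\rangle^n$ is the formal expression obtained by applying a unary structural operator $\langle\cdot\rangle$ $n$ times to the formula $\varphi$ ($\langle\varphi\rangle^0=\varphi$); if $\Gamma=\langle\varphi\rangle^n$ then $\langle\Gamma\rangle=\langle\varphi\rangle^{n+1}$. For a set of formulas $X$, $FS(X)=\{\langle\varphi\rangle^n\mid\varphi\in X,\ n\geq0\}$. The calculus $\mathsf{G}$ has axioms (arbitrary formulas, $n\geq0$): $\varphi\Rightarrow\varphi$; $\varphi\wedge(\psi\vee\chi)\Rightarrow(\varphi\wedge\psi)\vee(\varphi\wedge\chi)$; $\varphi\Rightarrow\top$; $\langle\bot\rangle^n\Rightarrow\psi$; $\varphi\wedge\neg\varphi\Rightarrow\bot$; $\top\Rightarrow\varphi\vee\neg\varphi$; $\Diamond^3\varphi\Rightarrow\Diamond^2\varphi$; and rules (arbitrary $n\geq0$): from $\langle\varphi_i\rangle^n\Rightarrow\psi$ infer $\langle\varphi_1\wedge\varphi_2\rangle^n\Rightarrow\psi$ ($i=1,2$); from $\Gamma\Rightarrow\psi_1$,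 $\Gamma\Rightarrow\psi_2$ infer $\Gamma\Rightarrow\psi_1\wedge\psi_2$; from $\langle\varphi_1\rangle^n\Rightarrow\psi$, $\langle\varphi_2\rangle^n\Rightarrow\psi$ infer $\langle\varphi_1\vee\varphi_2\rangle^n\Rightarrow\psi$; from $\Gamma\Rightarrow\psi_i$ infer $\Gamma\Rightarrow\psi_1\vee\psi_2$; from $\langle\varphi\rangle^{n+1}\Rightarrow\psi$ infer $\langle\Diamond\varphi\rangle^n\Rightarrow\psi$; from $\Gamma\Rightarrow\psi$ infer $\langle\Gamma\rangle\Rightarrow\Diamond\psi$; from $\langle\varphi\rangle^n\Rightarrow\psi$ infer $\langle\blacksquare\varphi\rangle^{n+1}\Rightarrow\psi$; from $\langle\Gamma\rangle\Rightarrow\psi$ infer $\Gamma\Rightarrow\blacksquare\psi$; from $\Gamma\Rightarrow\varphi$ and $\langle\varphi\rangle^n\Rightarrow\psi$ infer $\langle\Gamma\rangle^n\Rightarrow\psi$ (Cut). A derivation is a finite tree of sequents each node of which is an axiom instance or obtained from its children by a rule. $T^\Diamond=\{\Diamond^k\varphi\mid\varphi\in T,\ 0\leq k\leq 3\}$; $T^\circ$ is the smallest set containing $T^\Diamond$ closed under $\neg,\wedge,\vee$; $T^\bullet=T^\circ\setminus T^\Diamond$. $\mathsf{G}\vdash\Gamma\Rightarrow_{T^\circ}\psi$ means there is a derivation of $\Gamma\Rightarrow\psi$ in $\mathsf{G}$ all of whose formulas lie in $T^\circ$. For $\varphi\in T^\circ$: $G(\varphi)=\{\langle\chi\rangle^n\in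 FS(T^\Diamond)\mid\mathsf{G}\vdash\langle\chi\rangle^n\Rightarrow_{T^\circ}\varphi\}$, $[\![\varphi]\!]=G(\varphi)\cup FS(T^\bullet)$, $[\![T^\circ]\!]=\{[\![\varphi]\!]\mid\varphi\in T^\circ\}$. For $X\subseteq FS(T^\circ)$: $C(X)=\bigcap\{[\![\varphi]\!]\mid X\subseteq[\![\varphi]\!]\in[\![T^\circ]\!]\}$, $\Diamond X=\{\langle\Gamma\rangle\mid\Gamma\in X\}$, $\blacksquare X=\{\Gamma\in FS(T^\circ)\mid\langle\Gamma\rangle\in X\}$, $\Diamond_cX=C(\Diamond X)$. -}

module Defs where

open import Level using (0ℓ)
open import Data.Nat using (ℕ; zero; suc; _+_; _≤_)
open import Data.Product using (_×_; _,_; proj₁; proj₂; ∃; Σ-syntax)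
open import Data.Sum using (_⊎_)
open import Data.List using (List)
open import Data.List.Membership.Propositional using (_∈_)
open import Relation.Binary.PropositionalEquality using (_≡_)
open import Relation.Nullary using (¬_)
open import Relation.Unary using (Pred)

infixr 7 ~_ ◇_ ■_
infixl 6 _∧_
infixl 5 _∨_

data Fm : Set where
  var : ℕ → Fm
  bot top : Fm
  ~_ ◇_ ■_ : Fm → Fm
  _∧_ _∨_ : Fm → Fm → Fm

◇^ : ℕ → Fm → Fm
◇^ zero φ = φ
◇^ (suc k) φ = ◇ (◇^ k φ)

-- Formula structures: ⟨φ⟩^n is represented by the pair (n , φ)

FStr : Set
FStr = ℕ × Fm

⟨_⟩ : FStr → FStr
⟨ (n , φ) ⟩ = (suc n , φ)

⟨_⟩^_ : FStr → ℕ → FStr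
⟨ (m , φ) ⟩^ n = (n + m , φ)

fm : Fm → FStr
fm φ = (0 , φ)

-- Derivations in G all of whose formulas lie in S.
-- Each node (sequent Γ ⇒ ψ) carries the fact that the formula of the
-- structure Γ and the succedent ψ lie in S; premises are themselves nodes.

data Der (S : Pred Fm 0ℓ) : FStr → Fm → Set where
  ax-id   : ∀ {φ} → S φ → Der S (fm φ) φ
  ax-dist : ∀ {φ ψ χ} → S (φ ∧ (ψ ∨ χ)) → S ((φ ∧ ψ) ∨ (φ ∧ χ)) →
            Der S (fm (φ ∧ (ψ ∨ χ))) ((φ ∧ ψ) ∨ (φ ∧ χ))
  ax-top  : ∀ {φ} → S φ → S top → Der S (fm φ) top
  ax-bot  : ∀ {n ψ} → S bot → S ψ → Der S (n , bot) ψ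
  ax-neg₁ : ∀ {φ} → S (φ ∧ ~ φ) → S bot → Der S (fm (φ ∧ ~ φ)) bot
  ax-neg₂ : ∀ {φ} → S top → S (φ ∨ ~ φ) → Der S (fm top) (φ ∨ ~ φ)
  ax-◇32  : ∀ {φ} → S (◇^ 3 φ) → S (◇^ 2 φ) → Der S (fm (◇^ 3 φ)) (◇^ 2 φ)
  ∧L₁ : ∀ {n φ₁ φ₂ ψ} → S (φ₁ ∧ φ₂) → S ψ →
        Der S (n , φ₁) ψ → Der S (n , φ₁ ∧ φ₂) ψ
  ∧L₂ : ∀ {n φ₁ φ₂ ψ} → S (φ₁ ∧ φ₂) → S ψ →
        Der S (n , φ₂) ψ → Der S (n , φ₁ ∧ φ₂) ψ
  ∧R  : ∀ {Γ ψ₁ ψ₂} → S (proj₂ Γ) → S (ψ₁ ∧ ψ₂) →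
        Der S Γ ψ₁ → Der S Γ ψ₂ → Der S Γ (ψ₁ ∧ ψ₂)
  ∨L  : ∀ {n φ₁ φ₂ ψ} → S (φ₁ ∨ φ₂) → S ψ →
        Der S (n , φ₁) ψ → Der S (n , φ₂) ψ → Der S (n , φ₁ ∨ φ₂) ψ
  ∨R₁ : ∀ {Γ ψ₁ ψ₂} → S (proj₂ Γ) → S (ψ₁ ∨ ψ₂) →
        Der S Γ ψ₁ → Der S Γ (ψ₁ ∨ ψ₂)
  ∨R₂ : ∀ {Γ ψ₁ ψ₂} → S (proj₂ Γ) → S (ψ₁ ∨ ψ₂) →
        Der S Γ ψ₂ → Der S Γ (ψ₁ ∨ ψ₂)
  ◇L  : ∀ {n φ ψ} → S (◇ φ) → S ψ →
        Der S (suc n , φ) ψ → Der S (n , ◇ φ) ψ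
  ◇R  : ∀ {Γ ψ} → S (proj₂ Γ) → S (◇ ψ) →
        Der S Γ ψ → Der S ⟨ Γ ⟩ (◇ ψ)
  ■L  : ∀ {n φ ψ} → S (■ φ) → S ψ →
        Der S (n , φ) ψ → Der S (suc n , ■ φ) ψ
  ■R  : ∀ {Γ ψ} → S (proj₂ Γ) → S (■ ψ) →
        Der S ⟨ Γ ⟩ ψ → Der S Γ (■ ψ)
  cut : ∀ {Γ n φ ψ} → S (proj₂ Γ) → S ψ →
        Der S Γ φ → Der S (n , φ) ψ → Der S (⟨ Γ ⟩^ n) ψ

module _ (T : List Fm) where

  TD : Pred Fm 0ℓ
  TD χ = ∃ λ φ → φ ∈ T × Σ[ k ∈ ℕ ] (k ≤ 3 × χ ≡ ◇^ k φ)

  data TO : Fm → Set where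
    base : ∀ {χ} → TD χ → TO χ
    neg  : ∀ {χ} → TO χ → TO (~ χ)
    conj : ∀ {χ ξ} → TO χ → TO ξ → TO (χ ∧ ξ)
    disj : ∀ {χ ξ} → TO χ → TO ξ → TO (χ ∨ ξ)

  TB : Pred Fm 0ℓ
  TB χ = TO χ × ¬ TD χ

  FS : Pred Fm 0ℓ → Pred FStr 0ℓ
  FS X Γ = X (proj₂ Γ)

  G : Fm → Pred FStr 0ℓ
  G φ Γ = FS TD Γ × Der TO Γ φ

  ⟦_⟧ : Fm → Pred FStr 0ℓ
  ⟦ φ ⟧ Γ = G φ Γ ⊎ FS TB Γ

  C : Pred FStr 0ℓ → Pred FStr 0ℓ
  C X Γ = ∀ φ → TO φ → (∀ Δ → X Δ → ⟦ φ ⟧ Δ) → ⟦ φ ⟧ Γ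

  ◇S : Pred FStr 0ℓ → Pred FStr 0ℓ
  ◇S X Γ = ∃ λ Δ → X Δ × Γ ≡ ⟨ Δ ⟩

  ■S : Pred FStr 0ℓ → Pred FStr 0ℓ
  ■S X Γ = FS TO Γ × X ⟨ Γ ⟩

  ◇c : Pred FStr 0ℓ → Pred FStr 0ℓ
  ◇c X = C (◇S X)

module Submission where

-- It is the composite of two independent Galois-connection facts:
--
--   (1) C is a closure operator whose closed sets include every ⟦ψ⟧ with
--       ψ ∈ T°; hence, for such ψ,  C X ⊆ ⟦ψ⟧  iff  X ⊆ ⟦ψ⟧.
--   (2) The structural operators ◇X = {⟨Γ⟩ | Γ ∈ X} and ■ are adjoint on
--       sets of structures over T°:  ◇X ⊆ Y  iff  X ⊆ ■Y  when X ⊆ FS(T°).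
--
-- Since every structure in ⟦φ⟧ lies in FS(T°), taking X = ⟦φ⟧ and
-- Y = ⟦ψ⟧ and chaining (1) with (2) yields the corollary.

open import Defs
open import Data.Product using (_,_; proj₂)
open import Data.Sum using (inj₁; inj₂)
open import Data.List using (List)
open import Data.List.Membership.Propositional using (_∈_)
open import Function.Bundles using (_⇔_; mk⇔)
open import Function.Construct.Composition using (_⇔-∘_)
open import Relation.Unary using (Pred; _⊆_)
open import Relation.Unary.Properties using (⊆-trans)
open import Relation.Binary.PropositionalEquality using (refl)

module _ (T : List Fm) where

  ⟦⟧⊆FS-T° : (φ : Fm) → ⟦_⟧ T φ ⊆ FS T (TO T)
  ⟦⟧⊆FS-T° φ (inj₁ (inT◇ , _)) = base inT◇
  ⟦⟧⊆FS-T° φ (inj₂ (inT° , _)) = inT°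

  C-extensive : (X : Pred FStr _) → X ⊆ C T X
  C-extensive X {Γ} Γ∈X φ _ X⊆⟦φ⟧ = X⊆⟦φ⟧ Γ Γ∈X

  C-least : (X : Pred FStr _) (ψ : Fm) → TO T ψ →
            X ⊆ ⟦_⟧ T ψ → C T X ⊆ ⟦_⟧ T ψ
  C-least X ψ ψ∈T° X⊆⟦ψ⟧ Γ∈CX = Γ∈CX ψ ψ∈T° (λ _ → X⊆⟦ψ⟧)

  C⊆⟦⟧⇔⊆⟦⟧ : (X : Pred FStr _) (ψ : Fm) → TO T ψ →
             (C T X ⊆ ⟦_⟧ T ψ) ⇔ (X ⊆ ⟦_⟧ T ψ)
  C⊆⟦⟧⇔⊆⟦⟧ X ψ ψ∈T° =
    mk⇔ (⊆-trans (C-extensive X)) (C-least X ψ ψ∈T°)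

  -- Fact (2): ◇ is left adjoint to ■ on sets of structures over T°.  The
  -- side condition is needed because ■Y only contains structures of FS(T°).
  ◇S⊣■S : (X Y : Pred FStr _) → X ⊆ FS T (TO T) →
          (◇S T X ⊆ Y) ⇔ (X ⊆ ■S T Y)
  ◇S⊣■S X Y X⊆FS-T° = mk⇔ unit counit
    where
    unit : ◇S T X ⊆ Y → X ⊆ ■S T Y
    unit ◇X⊆Y {Γ} Γ∈X = X⊆FS-T° Γ∈X , ◇X⊆Y (Γ , Γ∈X , refl)

    counit : X ⊆ ■S T Y → ◇S T X ⊆ Y
    counit X⊆■Y (_ , Δ∈X , refl) = proj₂ (X⊆■Y Δ∈X)

corollary3p12 : (T : List Fm) → top ∈ T → bot ∈ T →
    (φ ψ : Fm) → TO T φ → TO T ψ →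
    (◇c T (⟦_⟧ T φ) ⊆ ⟦_⟧ T ψ) ⇔ (⟦_⟧ T φ ⊆ ■S T (⟦_⟧ T ψ))
corollary3p12 T _ _ φ ψ _ ψ∈T° =
  ◇S⊣■S T (⟦_⟧ T φ) (⟦_⟧ T ψ) (⟦⟧⊆FS-T° T φ)
    ⇔-∘ C⊆⟦⟧⇔⊆⟦⟧ T (◇S T (⟦_⟧ T φ)) ψ ψ∈T°
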